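{- Let $\Gamma$ be a greedoid and $f$ a $\Gamma$-attachment function. Let $A$ be a subset of the ground set of $\Gamma$ and let $F_1,F_2$ be maximal feasible subsets of $A$ (maximal with respect to inclusion among feasible sets contained in $A$). Then $f(F_1)=f(F_2)$.
   Context: A greedoid is a pair $\Gamma=(E,\mathcal F)$ with $E$ finite and $\mathcal F\subseteq 2^E$ (the feasible sets) such that $\emptyset\in\mathcal F$ and for all $F,F'\in\mathcal F$ with $|F'|<|F|$ there is $x\in F-F'$ with $F'\cup\{x\}\in\mathcal F$. The rank is $\rho(A)=\max\{|A'|:A'\subseteq A,A'\in\mathcal F\}$, $\rho(\Gamma)=\rho(E)$. The closure of $A\subseteq E$ is $\sigma(A)=\{e\in E:\rho(A\cup\{e\})=\rho(A)\}$. A $\Gamma$-attachment function is a map $f:\mathcal F\to 2^{[\rho(\Gamma)]}$ such that (i) $|f(F)|=\rho(F)$ for every $F\in\mathcal F$, and (ii) if $F_1,F_2\in\mathcal F$ and $F_1\subseteq\sigma(F_2)$ then $f(F_1)\subseteq f(F_2)$. -}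

module Defs where

open import Data.Nat using (ℕ; zero; suc; _<_; _⊔_)
open import Data.Bool using (Bool; true; false; T; if_then_else_)
open import Data.Fin using (Fin)
open import Data.Fin.Subset using (Subset; _∈_; _∉_; _⊆_; _∪_; ⁅_⁆; ∣_∣; ⊥)
open import Data.Fin.Subset.Properties using (_⊆?_)
open import Data.Vec using ([]; _∷_)
open import Data.List using (List; []; _∷_; map; _++_; foldr)
open import Data.Product using (Σ; _×_; _,_)
open import Relation.Nullary.Decidable using (⌊_⌋)
open import Relation.Binary.PropositionalEquality using (_≡_)

record Greedoid (n : ℕ) : Set where
  field
    feasible      : Subset n → Bool
    empty-feasible : T (feasible ⊥)
    augmentation  : (F F′ : Subset n) → T (feasible F) → T (feasible F′) →
                    ∣ F′ ∣ < ∣ F ∣ →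
                    Σ (Fin n) λ x → x ∈ F × x ∉ F′ × T (feasible (F′ ∪ ⁅ x ⁆))

allSubsets : (n : ℕ) → List (Subset n)
allSubsets zero    = [] ∷ []
allSubsets (suc n) = map (false ∷_) (allSubsets n) ++ map (true ∷_) (allSubsets n)

module _ {n : ℕ} (Γ : Greedoid n) where
  open Greedoid Γ

  -- ρ(A) = max { |A'| : A' ⊆ A, A' feasible }
  rank : Subset n → ℕ
  rank A = foldr (λ S m → if feasible S then (if ⌊ S ⊆? A ⌋ then ∣ S ∣ ⊔ m else m) else m)
                 0 (allSubsets n)

  rankΓ : ℕ
  rankΓ = rank (Data.Vec.replicate n true)

  -- e ∈ σ(A)  iff  ρ(A ∪ {e}) = ρ(A);  S ⊆ σ(A) stated pointwise
  _⊆σ_ : Subset n → Subset n → Set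
  S ⊆σ A = ∀ x → x ∈ S → rank (A ∪ ⁅ x ⁆) ≡ rank A

  -- Γ-attachment function f : 𝓕 → 2^[ρ(Γ)]   ([ρ(Γ)] represented as Fin ρ(Γ))
  record AttachmentFunction : Set where
    field
      f       : (F : Subset n) → T (feasible F) → Subset rankΓ
      f-size  : (F : Subset n) (p : T (feasible F)) → ∣ f F p ∣ ≡ rank F
      f-mono  : (F₁ F₂ : Subset n) (p₁ : T (feasible F₁)) (p₂ : T (feasible F₂)) →
                F₁ ⊆σ F₂ → f F₁ p₁ ⊆ f F₂ p₂

  MaximalFeasibleIn : Subset n → Subset n → Set
  MaximalFeasibleIn F A =
    T (feasible F) × F ⊆ A ×
    ((G : Subset n) → T (feasible G) → G ⊆ A → F ⊆ G → G ⊆ F)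

-- A maximal feasible subset F of A is in fact a maximum one: a larger feasible
-- S ⊆ A would, by augmentation, extend F by some element of S ⊆ A, against
-- maximality. Hence adding any element of A to F does not raise the rank, i.e.
-- A ⊆ σ(F). So two maximal feasible subsets F₁, F₂ of A lie in each other's
-- closure, and monotonicity of the attachment function gives f(F₁) ⊆ f(F₂) ⊆ f(F₁).
module Submission where

open import Defs
open import Data.Nat using (ℕ; zero; suc; _≤_; _⊔_; z≤n)
open import Data.Nat.Properties using (≤-trans; ≤-antisym; ⊔-lub; m≤m⊔n; m≤n⊔m; ≰⇒>; _≤?_)
open import Data.Bool using (true; false; T; if_then_else_)
open import Data.Unit using (tt)
open import Data.Empty using (⊥-elim)
open import Data.Fin.Subset using (Subset; _∈_; _⊆_; _∪_; ⁅_⁆; ∣_∣)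
open import Data.Fin.Subset.Properties
  using (_⊆?_; ⊆-refl; ⊆-trans; ⊆-antisym; p⊆p∪q; q⊆p∪q; x∈p∪q⁻; x∈⁅x⁆; x∈⁅y⁆⇒x≡y; p⊆q⇒∣p∣≤∣q∣)
open import Data.Vec using ([]; _∷_)
open import Data.List using (List; []; _∷_; map; foldr)
open import Data.List.Relation.Unary.Any using (here; there)
open import Data.List.Membership.Propositional renaming (_∈_ to _∈ₗ_)
open import Data.List.Membership.Propositional.Properties using (∈-++⁺ˡ; ∈-++⁺ʳ; ∈-map⁺)
open import Data.Product using (_,_; proj₁)
open import Data.Sum using (inj₁; inj₂)
open import Relation.Nullary using (yes; no)
open import Relation.Nullary.Decidable using (⌊_⌋)
open import Relation.Binary.PropositionalEquality using (_≡_; refl; sym; trans; subst)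

∈-allSubsets : ∀ {n} (S : Subset n) → S ∈ₗ allSubsets n
∈-allSubsets {zero}  []          = here refl
∈-allSubsets {suc n} (false ∷ S) = ∈-++⁺ˡ (∈-map⁺ (false ∷_) (∈-allSubsets S))
∈-allSubsets {suc n} (true ∷ S)  =
  ∈-++⁺ʳ (map (false ∷_) (allSubsets n)) (∈-map⁺ (true ∷_) (∈-allSubsets S))

∪-⁅⁆-⊆ : ∀ {n} {F A : Subset n} {x} → F ⊆ A → x ∈ A → F ∪ ⁅ x ⁆ ⊆ A
∪-⁅⁆-⊆ {F = F} {x = x} F⊆A x∈A {y} y∈ with x∈p∪q⁻ F ⁅ x ⁆ y∈
... | inj₁ y∈F   = F⊆A y∈F
... | inj₂ y∈⁅x⁆ = subst (_∈ _) (sym (x∈⁅y⁆⇒x≡y x y∈⁅x⁆)) x∈A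

module _ {n : ℕ} (Γ : Greedoid n) where
  open Greedoid Γ

  -- rank Γ A is definitionally rankOver A (allSubsets n).
  rankOver : Subset n → List (Subset n) → ℕ
  rankOver A = foldr (λ S m → if feasible S then (if ⌊ S ⊆? A ⌋ then ∣ S ∣ ⊔ m else m) else m) 0

  rankOver-≤ : ∀ A k → (∀ S → T (feasible S) → S ⊆ A → ∣ S ∣ ≤ k) →
               ∀ L → rankOver A L ≤ k
  rankOver-≤ A k bound []      = z≤n
  rankOver-≤ A k bound (S ∷ L) with feasible S in eq
  ... | false = rankOver-≤ A k bound L
  ... | true with S ⊆? A
  ...   | yes S⊆A = ⊔-lub (bound S (subst T (sym eq) tt) S⊆A) (rankOver-≤ A k bound L)
  ...   | no  _   = rankOver-≤ A k bound L

  ∣S∣≤rankOver : ∀ A S → T (feasible S) → S ⊆ A → ∀ {L} → S ∈ₗ L → ∣ S ∣ ≤ rankOver A L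
  ∣S∣≤rankOver A S feasS S⊆A (here refl) with feasible S | feasS
  ... | true | _ with S ⊆? A
  ...   | yes _   = m≤m⊔n _ _
  ...   | no S⊈A  = ⊥-elim (S⊈A S⊆A)
  ∣S∣≤rankOver A S feasS S⊆A {S′ ∷ L} (there S∈L) with feasible S′
  ... | false = ∣S∣≤rankOver A S feasS S⊆A S∈L
  ... | true with S′ ⊆? A
  ...   | yes _ = ≤-trans (∣S∣≤rankOver A S feasS S⊆A S∈L) (m≤n⊔m _ _)
  ...   | no  _ = ∣S∣≤rankOver A S feasS S⊆A S∈L

  rank-≤ : ∀ A k → (∀ S → T (feasible S) → S ⊆ A → ∣ S ∣ ≤ k) → rank Γ A ≤ k
  rank-≤ A k bound = rankOver-≤ A k bound (allSubsets n)

  ∣S∣≤rank : ∀ A S → T (feasible S) → S ⊆ A → ∣ S ∣ ≤ rank Γ A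
  ∣S∣≤rank A S feasS S⊆A = ∣S∣≤rankOver A S feasS S⊆A (∈-allSubsets S)

  rank-feasible : ∀ F → T (feasible F) → rank Γ F ≡ ∣ F ∣
  rank-feasible F feasF =
    ≤-antisym (rank-≤ F ∣ F ∣ (λ S _ S⊆F → p⊆q⇒∣p∣≤∣q∣ S⊆F)) (∣S∣≤rank F F feasF ⊆-refl)

  maximal⇒maximum : ∀ {F A} → MaximalFeasibleIn Γ F A →
                    ∀ S → T (feasible S) → S ⊆ A → ∣ S ∣ ≤ ∣ F ∣
  maximal⇒maximum {F} {A} (feasF , F⊆A , maximal) S feasS S⊆A with ∣ S ∣ ≤? ∣ F ∣
  ... | yes ∣S∣≤∣F∣ = ∣S∣≤∣F∣
  ... | no  ∣S∣≰∣F∣ with augmentation S F feasS feasF (≰⇒> ∣S∣≰∣F∣)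
  ...   | y , y∈S , y∉F , feasF∪y =
    ⊥-elim (y∉F (maximal (F ∪ ⁅ y ⁆) feasF∪y (∪-⁅⁆-⊆ F⊆A (S⊆A y∈S)) (p⊆p∪q _)
                         (q⊆p∪q F ⁅ y ⁆ (x∈⁅x⁆ y))))

  maximal⇒spans : ∀ {F A} → MaximalFeasibleIn Γ F A → _⊆σ_ Γ A F
  maximal⇒spans {F} m@(feasF , F⊆A , _) x x∈A =
    trans (≤-antisym rank≤∣F∣ ∣F∣≤rank) (sym (rank-feasible F feasF))
    where
    rank≤∣F∣ : rank Γ (F ∪ ⁅ x ⁆) ≤ ∣ F ∣
    rank≤∣F∣ = rank-≤ _ _ λ S feasS S⊆F∪x →
      maximal⇒maximum m S feasS (⊆-trans S⊆F∪x (∪-⁅⁆-⊆ F⊆A x∈A))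
    ∣F∣≤rank : ∣ F ∣ ≤ rank Γ (F ∪ ⁅ x ⁆)
    ∣F∣≤rank = ∣S∣≤rank _ F feasF (p⊆p∪q _)

  ⊆σ-⊆ˡ : ∀ {S S′ F} → S ⊆ S′ → _⊆σ_ Γ S′ F → _⊆σ_ Γ S F
  ⊆σ-⊆ˡ S⊆S′ S′⊆σF x x∈S = S′⊆σF x (S⊆S′ x∈S)

lemma4p2 : {n : ℕ} (Γ : Greedoid n) (att : AttachmentFunction Γ) (A F₁ F₂ : Subset n) →
    (m₁ : MaximalFeasibleIn Γ F₁ A) → (m₂ : MaximalFeasibleIn Γ F₂ A) →
    AttachmentFunction.f att F₁ (proj₁ m₁) ≡ AttachmentFunction.f att F₂ (proj₁ m₂)
lemma4p2 Γ att A F₁ F₂ m₁@(feas₁ , F₁⊆A , _) m₂@(feas₂ , F₂⊆A , _) =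
  ⊆-antisym (f-mono F₁ F₂ feas₁ feas₂ (⊆σ-⊆ˡ Γ F₁⊆A (maximal⇒spans Γ m₂)))
            (f-mono F₂ F₁ feas₂ feas₁ (⊆σ-⊆ˡ Γ F₂⊆A (maximal⇒spans Γ m₁)))
  where open AttachmentFunction att
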